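{- Let $T$ be a tree with vertex set $\{1,\ldots,n\}$ whose edges carry nonzero real weights. Let $D$, $\Delta$, $L$ be its weighted distance matrix, squared distance matrix and weighted Laplacian, let $\tilde\tau=\mathrm{diag}(\tau_1,\ldots,\tau_n)$ where $\tau_i=2-\delta_i$ and $\delta_i$ is the degree of vertex $i$, and let $\hat\delta$ be the vector of weighted degrees. Then $\Delta L=2D\tilde\tau-\mathbf{1}\hat\delta'$, where $\mathbf 1$ is the all-ones vector.
   Context: For vertices $i\neq j$, $d(i,j)$ is the sum of the weights of the edges on the unique $ij$-path, $d(i,i)=0$; $D=(d(i,j))$ and $\Delta=(d(i,j)^2)$. $L$ is the $n\times n$ matrix whose $(i,j)$-entry for $i\neq j$ is $-1/w$ if $i,j$ are joined by an edge of weight $w$ and $0$ if they are not adjacent, with diagonal entries making all row sums zero. The weighted degree $\hat\delta_i$ is the sum of the weights of the edges incident to $i$, and $\hat\delta=(\hat\delta_1,\ldots,\hat\delta_n)'$. A prime denotes transpose. -}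

module Defs where

open import Level using (Level; _⊔_; suc)
open import Algebra.Bundles using (CommutativeRing)
open import Data.Nat using (ℕ; zero; _≤_) renaming (suc to sucℕ)
open import Data.Fin using (Fin; _≟_) renaming (zero to fz; suc to fs)
open import Data.Maybe using (Maybe; just; nothing)
open import Data.List using (List; []; _∷_)
open import Data.List.Relation.Unary.Unique.Propositional using (Unique)
open import Data.Product using (Σ; proj₁; _×_; ∃)
open import Relation.Nullary using (¬_; yes; no)
open import Relation.Binary.PropositionalEquality using (_≡_)

-- A field: a commutative ring with 0 ≠ 1 in which every nonzero element
-- has a multiplicative inverse (given by a total function inv, whose value
-- at 0 is irrelevant).  The real numbers are an instance.
record Field (c ℓ : Level) : Set (suc (c ⊔ ℓ)) where
  field
    commutativeRing : CommutativeRing c ℓ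
  open CommutativeRing commutativeRing public
  field
    inv      : Carrier → Carrier
    inv-cong : ∀ {x y} → x ≈ y → inv x ≈ inv y
    inverse  : ∀ x → ¬ (x ≈ 0#) → x * inv x ≈ 1#
    0≉1      : ¬ (0# ≈ 1#)

module WeightedTree {c ℓ : Level} (F : Field c ℓ) where
  open Field F

  ∑ : {n : ℕ} → (Fin n → Carrier) → Carrier
  ∑ {zero}   f = 0#
  ∑ {sucℕ n} f = f fz + ∑ (λ i → f (fs i))

  -- A weighted graph on vertex set Fin n: W i j = just w iff i and j are
  -- joined by an edge of weight w, and nothing if they are not adjacent.
  WGraph : ℕ → Set c
  WGraph n = Fin n → Fin n → Maybe Carrier

  module _ {n : ℕ} (W : WGraph n) where

    data Walk : Fin n → Fin n → Set c where
      nil  : ∀ i → Walk i i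
      cons : ∀ {i j k} (w : Carrier) → W i j ≡ just w → Walk j k → Walk i k

    vertices : ∀ {i j} → Walk i j → List (Fin n)
    vertices (nil i) = i ∷ []
    vertices (cons {i} w _ p) = i ∷ vertices p

    len : ∀ {i j} → Walk i j → ℕ
    len (nil i) = 0
    len (cons w _ p) = sucℕ (len p)

    weight : ∀ {i j} → Walk i j → Carrier
    weight (nil i) = 0#
    weight (cons w _ p) = w + weight p

    IsPath : ∀ {i j} → Walk i j → Set
    IsPath p = Unique (vertices p)

    HasCycle : Set c
    HasCycle = Σ (Fin n) λ i → Σ (Fin n) λ j → Σ (Walk j i) λ p →
                 IsPath p × (2 ≤ len p) × (∃ λ w → W i j ≡ just w)

    record IsSimpleNonzero : Set (c ⊔ ℓ) where
      field
        loopless  : ∀ i → W i i ≡ nothing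
        symmetric : ∀ i j → W i j ≡ W j i
        nonzero   : ∀ i j w → W i j ≡ just w → ¬ (w ≈ 0#)

    record IsTree : Set (c ⊔ ℓ) where
      field
        simple    : IsSimpleNonzero
        connected : ∀ i j → Σ (Walk i j) IsPath
        acyclic   : ¬ HasCycle

    module _ (T : IsTree) where
      open IsTree T

      dist : Fin n → Fin n → Carrier
      dist i j = weight (proj₁ (connected i j))

      Dmat : Fin n → Fin n → Carrier
      Dmat = dist

      Δmat : Fin n → Fin n → Carrier
      Δmat i j = dist i j * dist i j

    adj1 : Fin n → Fin n → Carrier
    adj1 i j with W i j
    ... | just w  = 1#
    ... | nothing = 0#

    wt0 : Fin n → Fin n → Carrier
    wt0 i j with W i j
    ... | just w  = w
    ... | nothing = 0#

    invwt0 : Fin n → Fin n → Carrier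
    invwt0 i j with W i j
    ... | just w  = inv w
    ... | nothing = 0#

    deg : Fin n → Carrier
    deg i = ∑ (λ j → adj1 i j)

    wdeg : Fin n → Carrier
    wdeg i = ∑ (λ j → wt0 i j)

    τ : Fin n → Carrier
    τ i = (1# + 1#) - deg i

    Lmat : Fin n → Fin n → Carrier
    Lmat i j with i ≟ j
    ... | yes _ = ∑ (λ k → invwt0 i k)
    ... | no  _ = - invwt0 i j

  _⊗_ : {n : ℕ} → (Fin n → Fin n → Carrier) → (Fin n → Fin n → Carrier)
        → (Fin n → Fin n → Carrier)
  (A ⊗ B) i j = ∑ (λ k → A i k * B k j)

-- Column j of L is supported on j and its neighbours, so
-- (ΔL)_ij = Σ_{k ∼ j} (d_ij² − d_ik²) / w_jk.  In a tree a neighbour k of j either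
-- precedes j on the path from i (d_ij = d_ik + w_jk, contributing 2d_ij − w_jk) or
-- lies beyond j (d_ik = d_ij + w_jk, contributing −2d_ij − w_jk).  Exactly one
-- neighbour precedes j unless i = j, where d_ij = 0, so the sum is
-- 4d_ij − 2d_ij δ_j − δ̂_j = 2d_ij τ_j − δ̂_j.  The dichotomy rests on acyclicity:
-- two paths with the same ends have the same weight, and the only path between
-- adjacent vertices is the edge joining them.

module Submission where

open import Defs
open import Level using (Level)
open import Data.Nat using (ℕ; _≤_; z≤n; s≤s)
open import Data.Fin using (Fin; _≟_) renaming (zero to fz; suc to fs)
open import Data.Maybe using (just; nothing)
open import Data.Maybe.Properties using (just-injective)
open import Data.List using (_∷_)
open import Data.List.Membership.Propositional using (_∈_; _∉_)
open import Data.List.Relation.Binary.Subset.Propositional using (_⊆_)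
open import Data.List.Relation.Unary.Any using (here; there)
open import Data.List.Relation.Unary.AllPairs as AllPairs using ([]; _∷_)
open import Data.List.Relation.Unary.All using ([])
open import Data.List.Relation.Unary.All.Properties.Core using (¬Any⇒All¬)
open import Data.List.Relation.Unary.Unique.Propositional using (Unique)
open import Data.List.Relation.Unary.Unique.Propositional.Properties using (Unique[x∷xs]⇒x∉xs)
open import Data.Product using (∃; ∃₂; _×_; _,_; proj₁; proj₂)
open import Data.Sum using (_⊎_; inj₁; inj₂)
open import Data.Empty using (⊥; ⊥-elim)
open import Function using (_∘_)
open import Relation.Nullary using (yes; no)
open import Relation.Binary.PropositionalEquality as ≡ using (_≡_; _≢_; refl)
import Algebra.Properties.Ring as RingProperties
import Algebra.Properties.Semiring.Sum as SemiringSum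
import Algebra.Solver.Ring.NaturalCoefficients.Default as NaturalSolver
import Relation.Binary.Reasoning.Setoid as SetoidReasoning

unique-∷ : ∀ {a} {A : Set a} {x : A} {xs} → x ∉ xs → Unique xs → Unique (x ∷ xs)
unique-∷ {xs = xs} x∉xs xs-unique = ¬Any⇒All¬ xs x∉xs ∷ xs-unique

module _ {c ℓ : Level} (F : Field c ℓ) where
  open Field F renaming (refl to ≈-refl)
  open WeightedTree F
  open RingProperties ring using (-‿+-comm; -‿distribʳ-*)
  open SemiringSum semiring using (sum; sum-cong-≋; sum-replicate-zero; *-distribˡ-sum)
    renaming (∑-distrib-+ to sum-distrib-+)
  open NaturalSolver commutativeSemiring using (Polynomial; solve; _:+_; _:*_; _:=_; con)
  open SetoidReasoning setoid

  two : Carrier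
  two = 1# + 1#

  :two : ∀ {m} → Polynomial m
  :two = con 1 :+ con 1

  square-shift : ∀ {w x} → w * x ≈ 1# → ∀ a → (a + w) * (a + w) * x ≈ a * a * x + (two * a + w)
  square-shift {w} {x} wx≈1 a = begin
    (a + w) * (a + w) * x
      ≈⟨ solve 3 (λ a w x → (a :+ w) :* (a :+ w) :* x := a :* a :* x :+ (:two :* a :+ w) :* (w :* x)) ≈-refl a w x ⟩
    a * a * x + (two * a + w) * (w * x)
      ≈⟨ +-congˡ (trans (*-congˡ wx≈1) (*-identityʳ _)) ⟩
    a * a * x + (two * a + w) ∎

  parent-step : ∀ {w x d D} → w * x ≈ 1# → d ≈ D + w →
                d * d * x + (two * d * 1# + w) ≈ D * D * x + 1# * (two * (two * d))
  parent-step {w} {x} {d} {D} wx≈1 d≈D+w = begin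
    d * d * x + (two * d * 1# + w)
      ≈⟨ +-cong (*-congʳ (*-cong d≈D+w d≈D+w)) (+-congʳ (*-congʳ (*-congˡ d≈D+w))) ⟩
    (D + w) * (D + w) * x + (two * (D + w) * 1# + w)
      ≈⟨ +-congʳ (square-shift wx≈1 D) ⟩
    D * D * x + (two * D + w) + (two * (D + w) * 1# + w)
      ≈⟨ solve 3 (λ D w x → D :* D :* x :+ (:two :* D :+ w) :+ (:two :* (D :+ w) :* con 1 :+ w)
                   := D :* D :* x :+ con 1 :* (:two :* (:two :* (D :+ w)))) ≈-refl D w x ⟩
    D * D * x + 1# * (two * (two * (D + w)))
      ≈⟨ +-congˡ (*-congˡ (*-congˡ (*-congˡ (sym d≈D+w)))) ⟩
    D * D * x + 1# * (two * (two * d)) ∎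

  away-step : ∀ {w x d D} → w * x ≈ 1# → D ≈ d + w →
              d * d * x + (two * d * 1# + w) ≈ D * D * x + 0# * (two * (two * d))
  away-step {w} {x} {d} {D} wx≈1 D≈d+w = begin
    d * d * x + (two * d * 1# + w)                  ≈⟨ +-congˡ (+-congʳ (*-identityʳ _)) ⟩
    d * d * x + (two * d + w)                       ≈⟨ sym (square-shift wx≈1 d) ⟩
    (d + w) * (d + w) * x                           ≈⟨ sym (*-congʳ (*-cong D≈d+w D≈d+w)) ⟩
    D * D * x                                       ≈⟨ sym (+-identityʳ _) ⟩
    D * D * x + 0#                                  ≈⟨ +-congˡ (sym (zeroˡ _)) ⟩
    D * D * x + 0# * (two * (two * d))              ∎

  cancel-to-difference : ∀ {E X Y H C} → E + Y ≈ X → X + H ≈ Y + C → E ≈ C - H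
  cancel-to-difference {E} {X} {Y} {H} {C} E+Y≈X X+H≈Y+C = begin
    E
      ≈⟨ sym (+-identityʳ E) ⟩
    E + 0#
      ≈⟨ +-congˡ (sym (-‿inverseʳ (Y + H))) ⟩
    E + ((Y + H) - (Y + H))
      ≈⟨ solve 4 (λ E Y H N → E :+ ((Y :+ H) :+ N) := E :+ Y :+ H :+ N) ≈-refl E Y H (- (Y + H)) ⟩
    (E + Y + H) - (Y + H)
      ≈⟨ +-congʳ (trans (+-congʳ E+Y≈X) X+H≈Y+C) ⟩
    (Y + C) - (Y + H)
      ≈⟨ +-congˡ (sym (-‿+-comm Y H)) ⟩
    (Y + C) + (- Y + - H)
      ≈⟨ solve 4 (λ Y C nY nH → (Y :+ C) :+ (nY :+ nH) := (Y :+ nY) :+ (C :+ nH)) ≈-refl Y C (- Y) (- H) ⟩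
    (Y - Y) + (C - H)
      ≈⟨ trans (+-congʳ (-‿inverseʳ Y)) (+-identityˡ _) ⟩
    C - H ∎

  collect-τ : ∀ d g h → two * (two * d) - (two * d * g + h) ≈ two * (d * (two - g)) - 1# * h
  collect-τ d g h = begin
    two * (two * d) - (two * d * g + h)   ≈⟨ +-congˡ (sym (-‿+-comm _ h)) ⟩
    two * (two * d) + (- (two * d * g) + - h)
      ≈⟨ +-congˡ (+-congʳ (-‿distribʳ-* _ g)) ⟩
    two * (two * d) + (two * d * - g + - h)
      ≈⟨ solve 3 (λ d ng nh → :two :* (:two :* d) :+ (:two :* d :* ng :+ nh)
                   := :two :* (d :* (:two :+ ng)) :+ nh) ≈-refl d (- g) (- h) ⟩
    two * (d * (two - g)) - h             ≈⟨ +-congˡ (-‿cong (sym (*-identityˡ h))) ⟩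
    two * (d * (two - g)) - 1# * h        ∎

  ∑≡sum : ∀ {m} (f : Fin m → Carrier) → ∑ f ≡ sum f
  ∑≡sum {ℕ.zero}  f = refl
  ∑≡sum {ℕ.suc m} f = ≡.cong (f fz +_) (∑≡sum (f ∘ fs))

  ∑-cong : ∀ {m} {f g : Fin m → Carrier} → (∀ k → f k ≈ g k) → ∑ f ≈ ∑ g
  ∑-cong {f = f} {g} f≈g rewrite ∑≡sum f | ∑≡sum g = sum-cong-≋ f≈g

  ∑-distrib-+ : ∀ {m} (f g : Fin m → Carrier) → ∑ (λ k → f k + g k) ≈ ∑ f + ∑ g
  ∑-distrib-+ f g rewrite ∑≡sum (λ k → f k + g k) | ∑≡sum f | ∑≡sum g = sum-distrib-+ f g

  *-distribˡ-∑ : ∀ {m} x (f : Fin m → Carrier) → x * ∑ f ≈ ∑ (λ k → x * f k)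
  *-distribˡ-∑ x f rewrite ∑≡sum f | ∑≡sum (λ k → x * f k) = *-distribˡ-sum x f

  ∑-zero : ∀ m → ∑ {m} (λ _ → 0#) ≈ 0#
  ∑-zero m rewrite ∑≡sum {m} (λ _ → 0#) = sum-replicate-zero m

  δ : ∀ {m} → Fin m → Fin m → Carrier
  δ fz     fz     = 1#
  δ fz     (fs _) = 0#
  δ (fs _) fz     = 0#
  δ (fs a) (fs b) = δ a b

  δ-diag : ∀ {m} (a : Fin m) → δ a a ≡ 1#
  δ-diag fz     = refl
  δ-diag (fs a) = δ-diag a

  δ-offdiag : ∀ {m} {a b : Fin m} → a ≢ b → δ a b ≡ 0#
  δ-offdiag {a = fz}   {fz}   a≢b = ⊥-elim (a≢b refl)
  δ-offdiag {a = fz}   {fs _} a≢b = refl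
  δ-offdiag {a = fs _} {fz}   a≢b = refl
  δ-offdiag {a = fs a} {fs b} a≢b = δ-offdiag (a≢b ∘ ≡.cong fs)

  ∑-δ : ∀ {m} (j : Fin m) (f : Fin m → Carrier) → ∑ (λ k → δ k j * f k) ≈ f j
  ∑-δ {ℕ.suc m} fz f = begin
    1# * f fz + ∑ (λ k → 0# * f (fs k))
      ≈⟨ +-cong (*-identityˡ _) (∑-cong (λ k → zeroˡ (f (fs k)))) ⟩
    f fz + ∑ {m} (λ _ → 0#)             ≈⟨ +-congˡ (∑-zero m) ⟩
    f fz + 0#                           ≈⟨ +-identityʳ _ ⟩
    f fz                                ∎
  ∑-δ (fs j) f = begin
    0# * f fz + ∑ (λ k → δ k j * f (fs k))  ≈⟨ +-cong (zeroˡ _) (∑-δ j (f ∘ fs)) ⟩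
    0# + f (fs j)                           ≈⟨ +-identityˡ _ ⟩
    f (fs j)                                ∎

  module _ {n : ℕ} (W : WGraph n) where
    open import Data.List.Membership.DecPropositional (_≟_ {n}) using (_∈?_)

    infixr 5 _++_
    _++_ : ∀ {i j k} → Walk W i j → Walk W j k → Walk W i k
    nil _      ++ q = q
    cons w e p ++ q = cons w e (p ++ q)

    _∷ʳ_ : ∀ {i j k w} → Walk W i j → W j k ≡ just w → Walk W i k
    p ∷ʳ e = p ++ cons _ e (nil _)

    weight-++ : ∀ {i j k} (p : Walk W i j) (q : Walk W j k) → weight W (p ++ q) ≈ weight W p + weight W q
    weight-++ (nil _)      q = sym (+-identityˡ _)
    weight-++ (cons w e p) q = trans (+-congˡ (weight-++ p q)) (sym (+-assoc w _ _))

    weight-∷ʳ : ∀ {i j k w} (p : Walk W i j) (e : W j k ≡ just w) →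
                weight W (p ∷ʳ e) ≈ weight W p + w
    weight-∷ʳ p e = trans (weight-++ p _) (+-congˡ (+-identityʳ _))

    start-∈ : ∀ {i j} (p : Walk W i j) → i ∈ vertices W p
    start-∈ (nil _)      = here refl
    start-∈ (cons _ _ _) = here refl

    end-∈ : ∀ {i j} (p : Walk W i j) → j ∈ vertices W p
    end-∈ (nil _)      = here refl
    end-∈ (cons _ _ p) = there (end-∈ p)

    ∈-++⁺ˡ : ∀ {i j k x} (p : Walk W i j) (q : Walk W j k) →
             x ∈ vertices W p → x ∈ vertices W (p ++ q)
    ∈-++⁺ˡ (nil _)      q (here refl) = start-∈ q
    ∈-++⁺ˡ (cons _ _ p) q (here x≡i)  = here x≡i
    ∈-++⁺ˡ (cons _ _ p) q (there x∈)  = there (∈-++⁺ˡ p q x∈)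

    ∈-++⁺ʳ : ∀ {i j k x} (p : Walk W i j) (q : Walk W j k) →
             x ∈ vertices W q → x ∈ vertices W (p ++ q)
    ∈-++⁺ʳ (nil _)      q x∈ = x∈
    ∈-++⁺ʳ (cons _ _ p) q x∈ = there (∈-++⁺ʳ p q x∈)

    ∈-++⁻ : ∀ {i j k x} (p : Walk W i j) (q : Walk W j k) →
            x ∈ vertices W (p ++ q) → x ∈ vertices W p ⊎ x ∈ vertices W q
    ∈-++⁻ (nil _)      q x∈          = inj₂ x∈
    ∈-++⁻ (cons _ _ p) q (here x≡i)  = inj₁ (here x≡i)
    ∈-++⁻ (cons _ _ p) q (there x∈) with ∈-++⁻ p q x∈
    ... | inj₁ x∈p = inj₁ (there x∈p)
    ... | inj₂ x∈q = inj₂ x∈q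

    ∈-∷ʳ⁻ : ∀ {i j k w x} (p : Walk W i j) (e : W j k ≡ just w) →
            x ∈ vertices W (p ∷ʳ e) → x ∈ vertices W p ⊎ x ≡ k
    ∈-∷ʳ⁻ p e x∈ with ∈-++⁻ p _ x∈
    ... | inj₁ x∈p                = inj₁ x∈p
    ... | inj₂ (here refl)        = inj₁ (end-∈ p)
    ... | inj₂ (there (here x≡k)) = inj₂ x≡k

    path-++⁻ˡ : ∀ {i j k} (p : Walk W i j) (q : Walk W j k) → IsPath W (p ++ q) → IsPath W p
    path-++⁻ˡ (nil _)      q _      = [] ∷ []
    path-++⁻ˡ (cons _ _ p) q pq-path =
      unique-∷ (Unique[x∷xs]⇒x∉xs pq-path ∘ ∈-++⁺ˡ p q) (path-++⁻ˡ p q (AllPairs.tail pq-path))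

    path-++⁻ʳ : ∀ {i j k} (p : Walk W i j) (q : Walk W j k) → IsPath W (p ++ q) → IsPath W q
    path-++⁻ʳ (nil _)      q pq-path = pq-path
    path-++⁻ʳ (cons _ _ p) q pq-path = path-++⁻ʳ p q (AllPairs.tail pq-path)

    path-∷ʳ : ∀ {i j k w} (p : Walk W i j) (e : W j k ≡ just w) →
              IsPath W p → k ∉ vertices W p → IsPath W (p ∷ʳ e)
    path-∷ʳ (nil _) e _ k∉p =
      unique-∷ (λ { (here i≡k) → k∉p (here (≡.sym i≡k)) ; (there ()) }) ([] ∷ [])
    path-∷ʳ (cons _ _ p) e p-path k∉p =
      unique-∷ i∉ (path-∷ʳ p e (AllPairs.tail p-path) (k∉p ∘ there))
      where
      i∉ : _ ∉ vertices W (p ∷ʳ e)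
      i∉ x∈ with ∈-∷ʳ⁻ p e x∈
      ... | inj₁ i∈p = Unique[x∷xs]⇒x∉xs p-path i∈p
      ... | inj₂ i≡k = k∉p (here (≡.sym i≡k))

    split : ∀ {i j x} (p : Walk W i j) → x ∈ vertices W p →
            ∃₂ λ (r : Walk W i x) (s : Walk W x j) → p ≡ r ++ s
    split (nil i)      (here refl) = nil i , nil i , refl
    split (cons w e p) (here refl) = nil _ , cons w e p , refl
    split (cons w e p) (there x∈) with split p x∈
    ... | r , s , refl = cons w e r , s , refl

    toPath : ∀ {i j} (p : Walk W i j) → ∃ λ (q : Walk W i j) → IsPath W q × vertices W q ⊆ vertices W p
    toPath (nil i) = nil i , [] ∷ [] , λ x∈ → x∈
    toPath (cons {i} w e p) with toPath p
    ... | q , q-path , q⊆p with i ∈? vertices W q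
    ...   | no i∉q =
      cons w e q , unique-∷ i∉q q-path , λ { (here x≡i) → here x≡i ; (there x∈) → there (q⊆p x∈) }
    ...   | yes i∈q with split q i∈q
    ...     | r , s , refl = s , path-++⁻ʳ r s q-path , there ∘ q⊆p ∘ ∈-++⁺ʳ r s

    penult : ∀ {i j} → Walk W i j → Fin n
    penult (nil i)                     = i
    penult (cons {i} _ _ (nil _))      = i
    penult (cons _ _ p@(cons _ _ _))   = penult p

    penult-∈ : ∀ {i j} (p : Walk W i j) → penult p ∈ vertices W p
    penult-∈ (nil _)                   = here refl
    penult-∈ (cons _ _ (nil _))        = here refl
    penult-∈ (cons _ _ p@(cons _ _ _)) = there (penult-∈ p)

    penult-∷ʳ : ∀ {i j k w} (p : Walk W i j) (e : W j k ≡ just w) → penult (p ∷ʳ e) ≡ j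
    penult-∷ʳ (nil _)                   e = refl
    penult-∷ʳ (cons _ _ (nil _))        e = refl
    penult-∷ʳ (cons _ _ p@(cons _ _ _)) e = penult-∷ʳ p e

    penult-adjacent : ∀ {i a j w} (e : W i a ≡ just w) (p : Walk W a j) →
                      ∃ λ v → W (penult (cons w e p)) j ≡ just v
    penult-adjacent e (nil _)        = _ , e
    penult-adjacent e (cons _ e′ p) = penult-adjacent e′ p

    module _ (symmetric : ∀ i j → W i j ≡ W j i) where

      reverse : ∀ {i j} → Walk W i j → Walk W j i
      reverse (nil i)              = nil i
      reverse (cons {i} {a} w e p) = reverse p ∷ʳ ≡.trans (symmetric a i) e

      ∈-reverse⁻ : ∀ {i j x} (p : Walk W i j) → x ∈ vertices W (reverse p) → x ∈ vertices W p
      ∈-reverse⁻ (nil _) x∈ = x∈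
      ∈-reverse⁻ (cons {i} {a} w e p) x∈ with ∈-∷ʳ⁻ (reverse p) (≡.trans (symmetric a i) e) x∈
      ... | inj₁ x∈p = there (∈-reverse⁻ p x∈p)
      ... | inj₂ x≡i = here x≡i

    module _ (G : IsSimpleNonzero W) where
      open IsSimpleNonzero G

      invwt0-symmetric : ∀ a b → invwt0 W a b ≡ invwt0 W b a
      invwt0-symmetric a b rewrite symmetric a b = refl

      invwt0-diag : ∀ a → invwt0 W a a ≡ 0#
      invwt0-diag a rewrite loopless a = refl

      Lmat-+-invwt0 : ∀ k j → Lmat W k j + invwt0 W j k ≈ δ k j * ∑ (invwt0 W j)
      Lmat-+-invwt0 k j with k ≟ j
      ... | yes refl = begin
        ∑ (invwt0 W k) + invwt0 W k k   ≈⟨ +-congˡ (reflexive (invwt0-diag k)) ⟩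
        ∑ (invwt0 W k) + 0#             ≈⟨ +-identityʳ _ ⟩
        ∑ (invwt0 W k)                  ≈⟨ sym (*-identityˡ _) ⟩
        1# * ∑ (invwt0 W k)             ≈⟨ *-congʳ (reflexive (≡.sym (δ-diag k))) ⟩
        δ k k * ∑ (invwt0 W k)          ∎
      ... | no k≢j = begin
        - invwt0 W k j + invwt0 W j k   ≈⟨ +-congˡ (reflexive (invwt0-symmetric j k)) ⟩
        - invwt0 W k j + invwt0 W k j   ≈⟨ -‿inverseˡ _ ⟩
        0#                              ≈⟨ sym (zeroˡ _) ⟩
        0# * ∑ (invwt0 W j)             ≈⟨ *-congʳ (reflexive (≡.sym (δ-offdiag k≢j))) ⟩
        δ k j * ∑ (invwt0 W j)          ∎

      ⊗-Lmat : (A : Fin n → Fin n → Carrier) → ∀ i j →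
               (A ⊗ Lmat W) i j + ∑ (λ k → A i k * invwt0 W j k) ≈ A i j * ∑ (invwt0 W j)
      ⊗-Lmat A i j = begin
        ∑ (λ k → A i k * Lmat W k j) + ∑ (λ k → A i k * invwt0 W j k)
          ≈⟨ sym (∑-distrib-+ (λ k → A i k * Lmat W k j) (λ k → A i k * invwt0 W j k)) ⟩
        ∑ (λ k → A i k * Lmat W k j + A i k * invwt0 W j k)
          ≈⟨ ∑-cong (λ k → trans (sym (distribˡ _ _ _)) (*-congˡ (Lmat-+-invwt0 k j))) ⟩
        ∑ (λ k → A i k * (δ k j * S))
          ≈⟨ ∑-cong (λ k → x*[y*z]≈y*[x*z] (A i k) (δ k j) S) ⟩
        ∑ (λ k → δ k j * (A i k * S))
          ≈⟨ ∑-δ j (λ k → A i k * S) ⟩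
        A i j * S ∎
        where
        S = ∑ (invwt0 W j)
        x*[y*z]≈y*[x*z] : ∀ x y z → x * (y * z) ≈ y * (x * z)
        x*[y*z]≈y*[x*z] = solve 3 (λ x y z → x :* (y :* z) := y :* (x :* z)) ≈-refl

    module _ (T : IsTree W) where
      open IsTree T
      open IsSimpleNonzero simple

      path : ∀ i j → Walk W i j
      path i j = proj₁ (connected i j)

      path-isPath : ∀ i j → IsPath W (path i j)
      path-isPath i j = proj₂ (connected i j)

      parent : Fin n → Fin n → Fin n
      parent i j = penult (path i j)

      nonempty : ∀ {a b} → a ≢ b → (p : Walk W a b) → 1 ≤ len W p
      nonempty a≢b (nil _)      = ⊥-elim (a≢b refl)
      nonempty a≢b (cons _ _ _) = s≤s z≤n

      no-detour : ∀ {i a b w w′} → W i a ≡ just w → W i b ≡ just w′ → a ≢ b →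
                  (r : Walk W a b) → i ∉ vertices W r → ⊥
      no-detour {i} {a} {b} e e′ a≢b r i∉r with toPath r
      ... | q , q-path , q⊆r =
        acyclic (b , i , cons _ e q , unique-∷ (i∉r ∘ q⊆r) q-path , s≤s (nonempty a≢b q) ,
                 _ , ≡.trans (symmetric b i) e′)

      paths-same-weight : ∀ {i j} (p q : Walk W i j) → IsPath W p → IsPath W q → weight W p ≈ weight W q
      paths-same-weight (nil _) (nil _) _ _ = ≈-refl
      paths-same-weight (nil _) (cons _ _ q) _ q-path = ⊥-elim (Unique[x∷xs]⇒x∉xs q-path (end-∈ q))
      paths-same-weight (cons _ _ p) (nil _) p-path _ = ⊥-elim (Unique[x∷xs]⇒x∉xs p-path (end-∈ p))
      paths-same-weight (cons {i} {a} w e p) (cons {_} {b} w′ e′ q) p-path q-path with a ≟ b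
      ... | yes refl = +-cong (reflexive (just-injective (≡.trans (≡.sym e) e′)))
                              (paths-same-weight p q (AllPairs.tail p-path) (AllPairs.tail q-path))
      ... | no a≢b = ⊥-elim (no-detour e e′ a≢b (p ++ reverse symmetric q) i∉)
        where
        i∉ : i ∉ vertices W (p ++ reverse symmetric q)
        i∉ i∈ with ∈-++⁻ p _ i∈
        ... | inj₁ i∈p = Unique[x∷xs]⇒x∉xs p-path i∈p
        ... | inj₂ i∈q = Unique[x∷xs]⇒x∉xs q-path (∈-reverse⁻ symmetric q i∈q)

      dist-path : ∀ {i j} (p : Walk W i j) → IsPath W p → dist W T i j ≈ weight W p
      dist-path {i} {j} p = paths-same-weight (path i j) p (path-isPath i j)

      path-between-neighbours : ∀ {j k w} (s : Walk W k j) → IsPath W s → W j k ≡ just w →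
                                ∃ λ (e′ : W k j ≡ just w) → s ≡ cons w e′ (nil j)
      path-between-neighbours {j} (nil _) _ e with ≡.trans (≡.sym (loopless j)) e
      ... | ()
      path-between-neighbours {j} {k} (cons _ e′ (nil _)) _ e
        with just-injective (≡.trans (≡.sym e′) (≡.trans (symmetric k j) e))
      ... | refl = e′ , refl
      path-between-neighbours {j} {k} s@(cons _ _ (cons _ _ _)) s-path e =
        ⊥-elim (acyclic (j , k , s , s-path , s≤s (s≤s z≤n) , _ , e))

      neighbour-on-path : ∀ {i j k w} → W j k ≡ just w → k ∈ vertices W (path i j) →
                          k ≡ parent i j × dist W T i j ≈ dist W T i k + w
      neighbour-on-path {i} {j} e k∈ with split (path i j) k∈
      ... | r , s , path≡r++s
        with path-between-neighbours s (path-++⁻ʳ r s (≡.subst (IsPath W) path≡r++s (path-isPath i j))) e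
      ... | e′ , refl =
          ≡.sym (≡.trans (≡.cong penult path≡r++s) (penult-∷ʳ r e′))
        , (begin
            weight W (path i j)     ≡⟨ ≡.cong (weight W) path≡r++s ⟩
            weight W (r ∷ʳ e′)      ≈⟨ weight-∷ʳ r e′ ⟩
            weight W r + _          ≈⟨ +-congʳ (sym (dist-path r r-path)) ⟩
            dist W T i _ + _        ∎)
        where
        r-path = path-++⁻ˡ r _ (≡.subst (IsPath W) path≡r++s (path-isPath i j))

      neighbour-off-path : ∀ {i j k w} (e : W j k ≡ just w) → k ∉ vertices W (path i j) →
                           dist W T i k ≈ dist W T i j + w
      neighbour-off-path {i} {j} e k∉ =
        trans (dist-path (path i j ∷ʳ e) (path-∷ʳ (path i j) e (path-isPath i j) k∉))
              (weight-∷ʳ (path i j) e)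

      parent-adjacent : ∀ i j → i ≡ j ⊎ ∃ λ w → W (parent i j) j ≡ just w
      parent-adjacent i j with connected i j
      ... | nil _ , _      = inj₁ refl
      ... | cons _ e p , _ = inj₂ (penult-adjacent e p)

      dist-refl : ∀ i → dist W T i i ≈ 0#
      dist-refl i = dist-path (nil i) ([] ∷ [])

      -- For k ∼ j: (d_ij² − d_ik²) / w_jk = 4d_ij [k = parent i j] − 2d_ij − w_jk,
      -- with the negative terms moved across so that no subtraction occurs.
      Δ-invwt0-step : ∀ i j k → let d = dist W T i j in
        Δmat W T i j * invwt0 W j k + (two * d * adj1 W j k + wt0 W j k)
          ≈ Δmat W T i k * invwt0 W j k + δ k (parent i j) * (two * (two * d))
      Δ-invwt0-step i j k with W j k in e
      ... | just w with k ≟ parent i j | inverse w (nonzero j k w e)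
      ...   | yes refl | w*w⁻¹≈1 =
        trans (parent-step w*w⁻¹≈1 (proj₂ (neighbour-on-path e (penult-∈ (path i j)))))
              (+-congˡ (*-congʳ (reflexive (≡.sym (δ-diag k)))))
      ...   | no k≢p   | w*w⁻¹≈1 =
        trans (away-step w*w⁻¹≈1 (neighbour-off-path e (k≢p ∘ proj₁ ∘ neighbour-on-path e)))
              (+-congˡ (*-congʳ (reflexive (≡.sym (δ-offdiag k≢p)))))
      Δ-invwt0-step i j k | nothing = trans zeros (+-congˡ (sym parent-term≈0))
        where
        zeros : ∀ {a b c} → a * 0# + (b * 0# + 0#) ≈ c * 0# + 0#
        zeros {a} {b} {c} =
          solve 3 (λ a b c → a :* con 0 :+ (b :* con 0 :+ con 0) := c :* con 0 :+ con 0) ≈-refl a b c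
        parent-term≈0 : δ k (parent i j) * (two * (two * dist W T i j)) ≈ 0#
        parent-term≈0 with parent-adjacent i j
        ... | inj₁ refl = trans (*-congˡ (*-congˡ (*-congˡ (dist-refl i))))
                                (solve 1 (λ x → x :* (:two :* (:two :* con 0)) := con 0) ≈-refl _)
        ... | inj₂ (_ , e′) = trans (*-congʳ (reflexive (δ-offdiag k≢p))) (zeroˡ _)
          where
          k≢p : k ≢ parent i j
          k≢p refl with ≡.trans (≡.sym e) (≡.trans (symmetric j k) e′)
          ... | ()

      Δ-invwt0-sum : ∀ i j → let d = dist W T i j in
        Δmat W T i j * ∑ (invwt0 W j) + (two * d * deg W j + wdeg W j)
          ≈ ∑ (λ k → Δmat W T i k * invwt0 W j k) + two * (two * d)
      Δ-invwt0-sum i j = begin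
        Δmat W T i j * ∑ (invwt0 W j) + (two * d * deg W j + wdeg W j)
          ≈⟨ +-cong (*-distribˡ-∑ _ (invwt0 W j)) (+-congʳ (*-distribˡ-∑ _ (adj1 W j))) ⟩
        ∑ (λ k → Δmat W T i j * invwt0 W j k) + (∑ (λ k → two * d * adj1 W j k) + wdeg W j)
          ≈⟨ +-congˡ (sym (∑-distrib-+ (λ k → two * d * adj1 W j k) (wt0 W j))) ⟩
        ∑ (λ k → Δmat W T i j * invwt0 W j k) + ∑ (λ k → two * d * adj1 W j k + wt0 W j k)
          ≈⟨ sym (∑-distrib-+ (λ k → Δmat W T i j * invwt0 W j k) _) ⟩
        ∑ (λ k → Δmat W T i j * invwt0 W j k + (two * d * adj1 W j k + wt0 W j k))
          ≈⟨ ∑-cong (Δ-invwt0-step i j) ⟩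
        ∑ (λ k → Δmat W T i k * invwt0 W j k + δ k (parent i j) * (two * (two * d)))
          ≈⟨ ∑-distrib-+ (λ k → Δmat W T i k * invwt0 W j k) _ ⟩
        ∑ (λ k → Δmat W T i k * invwt0 W j k) + ∑ (λ k → δ k (parent i j) * (two * (two * d)))
          ≈⟨ +-congˡ (∑-δ (parent i j) (λ _ → two * (two * d))) ⟩
        ∑ (λ k → Δmat W T i k * invwt0 W j k) + two * (two * d) ∎
        where d = dist W T i j

lemma2p4 : {c ℓ : Level} (F : Field c ℓ) (n : ℕ) (W : WeightedTree.WGraph F n)
    (T : WeightedTree.IsTree F W) →
    let open Field F
        open WeightedTree F
    in ∀ (i j : Fin n) →
       (Δmat W T ⊗ Lmat W) i j ≈ ((1# + 1#) * (Dmat W T i j * τ W j)) - (1# * wdeg W j)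
lemma2p4 F n W T i j =
  trans (cancel-to-difference F (⊗-Lmat F W (IsTree.simple T) (Δmat W T) i j) (Δ-invwt0-sum F W T i j))
        (collect-τ F (dist W T i j) (deg W j) (wdeg W j))
  where
  open Field F
  open WeightedTree F
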